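{- Let $p$ be an odd prime, $1\le i\le\frac{p-1}{2}$, and let $\beta_i$ be the tuple obtained by arranging $i,\ i+p,\ \dots,\ i+(p-1)p,\ p(p-i)$ in increasing order. Then $p(p-i)$ lies in the second half of $\beta_i$ (i.e. in a position strictly greater than $\frac{p+1}{2}$), so under the convention of replacing each entry $b_j$ in position $j>\frac{p+1}{2}$ by $b_j-p^2$ it is replaced by $-pi$. Consequently the Hodge class associated to $\beta_i$ has $\overline{\omega}_{pi}$ as one of its factors.
   Context: On the curve $y^2=x^{p^2}-1$ of genus $g=\frac{p^2-1}{2}$, $\omega_b=x^{b-1}dx/y$ for $1\le b\le g$, and for $g<b\le p^2-1$ one writes $\omega_b=\overline{\omega}_{p^2-b}$. The Hodge class associated to a tuple $(b_1,\dots,b_{2d})$ is $\omega_{b_1}\wedge\cdots\wedge\omega_{b_{2d}}$. -}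

module Defs where

open import Data.Nat using (ℕ; zero; suc; _+_; _*_; _∸_; _^_; _≤_; _<_; _≤?_; _<?_)
open import Data.Nat.Properties using (≤-decTotalOrder)
open import Data.Nat.Divisibility using (_∣_)
open import Data.Integer as ℤ using (ℤ; +_)
open import Data.List using (List; map; upTo; _++_; [_])
open import Relation.Nullary using (does)
open import Data.Bool using (if_then_else_)
import Data.List.Sort.InsertionSort.Base as IS

sortℕ : List ℕ → List ℕ
sortℕ = IS.sort ≤-decTotalOrder

beta : ℕ → ℕ → List ℕ
beta p i = sortℕ (map (λ k → i + k * p) (upTo p) ++ [ p * (p ∸ i) ])

-- genus g = (p^2 - 1)/2 of y^2 = x^{p^2} - 1 (p odd, so p^2-1 is even)
genus : ℕ → ℕ
genus p = (p ^ 2 ∸ 1) Data.Nat./ 2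

-- convention: entry b in (1-indexed) position j > (p+1)/2 is replaced by b - p^2.
-- Here the position argument is 0-indexed (position j0 means 1-indexed j0+1).
normEntry : ℕ → ℕ → ℕ → ℤ
normEntry p j0 b =
  if does ((p + 1) Data.Nat./ 2 <? suc j0) then (+ b) ℤ.- (+ (p ^ 2)) else + b

-- differential forms: hol b = ω_b = x^{b-1}dx/y ; conj c = \bar{ω}_c
data Form : Set where
  hol  : ℕ → Form
  conj : ℕ → Form

omega : ℕ → ℕ → Form
omega p b = if does (b ≤? genus p) then hol b else conj (p ^ 2 ∸ b)

-- the Hodge class ω_{b_1} ∧ … ∧ ω_{b_{2d}} represented by its list of factors
hodgeClass : ℕ → List ℕ → List Form
hodgeClass p bs = map (omega p) bs

{-# OPTIONS --safe #-}
-- Put m = p - i. The entries i + kp of β_i lie below p·m for k < m (as i < p) and above it for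
-- k ≥ m, so sorting inserts p·m after the first m terms of the progression; this is forced since
-- two sorted permutations of the same list coincide. Thus p·m sits at position m + 1, and 2i < p
-- gives p < 2m, which puts that position past (p + 1)/2 and p·m past the genus (p² - 1)/2. Both
-- the normalisation and ω then send p·m to p² - p·m = p·i.
module Submission where

open import Defs
open import Data.Nat using (ℕ; suc; _+_; _*_; _∸_; _≤_; _<_; _/_)
open import Data.Nat.Primality using (Prime)
open import Data.Integer as ℤ using (+_)
open import Data.Fin using (Fin; toℕ)
open import Data.List using (length; lookup)
open import Data.List.Membership.Propositional using (_∈_)
open import Data.Product using (Σ; _×_)
open import Relation.Binary.PropositionalEquality using (_≡_; _≢_)

open import Data.Nat using (zero; _^_; _≤?_; _<?_; s≤s; z≤n)
open import Data.Nat.Properties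
open import Data.Nat.DivMod using (m/n*n≤m; m<n*o⇒m/o<n)
import Data.Integer.Properties as ℤ
open import Data.Fin using (zero; suc)
open import Data.List using (List; []; _∷_; _++_; [_]; applyUpTo; upTo; map)
open import Data.List.Properties using (length-applyUpTo; map-upTo)
open import Data.List.Relation.Unary.All using (All; []; _∷_)
import Data.List.Relation.Unary.All.Properties as All
import Data.List.Relation.Unary.Linked as Linked
open import Data.List.Relation.Unary.Linked using ([-]; _∷_)
open import Data.List.Relation.Unary.Sorted.TotalOrder ≤-totalOrder using (Sorted)
open import Data.List.Relation.Unary.Sorted.TotalOrder.Properties using (↗↭↗⇒≋; applyUpTo⁺₂)
open import Data.List.Relation.Binary.Permutation.Propositional using (_↭_; ↭-trans; ↭-sym; ↭⇒↭ₛ)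
open import Data.List.Relation.Binary.Permutation.Propositional.Properties using (++⁺ˡ; ++-comm; ++-assoc)
open import Data.List.Relation.Binary.Pointwise using (Pointwise-≡⇒≡)
open import Data.List.Sort.InsertionSort.Base ≤-decTotalOrder using (sort)
open import Data.List.Sort.InsertionSort.Properties ≤-decTotalOrder using (sort-↭; sort-↗)
open import Data.List.Membership.Propositional.Properties using (∈-map⁺; ∈-lookup)
open import Data.Product using (_,_; ∃; proj₁; proj₂)
open import Relation.Nullary.Decidable using (dec-true; dec-false)
open import Relation.Nullary.Negation using (contradiction)
open import Relation.Binary.PropositionalEquality using (refl; sym; trans; cong; subst; module ≡-Reasoning)

sort-unique : ∀ {xs ys} → Sorted xs → xs ↭ ys → sort ys ≡ xs
sort-unique {xs} {ys} xs↗ xs↭ys = Pointwise-≡⇒≡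
  (↗↭↗⇒≋ ≤-totalOrder (sort-↗ ys) xs↗ (↭⇒↭ₛ (↭-trans (sort-↭ ys) (↭-sym xs↭ys))))

↗-insertBetween : ∀ {x} xs {ys} → Sorted (xs ++ ys) → All (_≤ x) xs → All (x ≤_) ys →
                  Sorted (xs ++ x ∷ ys)
↗-insertBetween []           {[]}    _          _          _         = [-]
↗-insertBetween []           {_ ∷ _} ys↗        _          (x≤y ∷ _) = x≤y ∷ ys↗
↗-insertBetween (_ ∷ [])             xs++ys↗    (a≤x ∷ _)  x≤ys =
  a≤x ∷ ↗-insertBetween [] (Linked.tail xs++ys↗) [] x≤ys
↗-insertBetween (_ ∷ b ∷ xs)         (a≤b ∷ s)  (_ ∷ xs≤x) x≤ys =
  a≤b ∷ ↗-insertBetween (b ∷ xs) s xs≤x x≤ys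

sort-separated : ∀ x {xs ys} → Sorted (xs ++ ys) → All (_≤ x) xs → All (x ≤_) ys →
                 sort ((xs ++ ys) ++ [ x ]) ≡ xs ++ x ∷ ys
sort-separated x {xs} {ys} xs++ys↗ xs≤x x≤ys =
  sort-unique (↗-insertBetween xs xs++ys↗ xs≤x x≤ys) (↭-trans (++⁺ˡ xs (++-comm (x ∷ []) ys)) (↭-sym (++-assoc xs ys [ x ])))

applyUpTo-+ : ∀ {a} {A : Set a} (f : ℕ → A) m n →
              applyUpTo f (m + n) ≡ applyUpTo f m ++ applyUpTo (λ k → f (m + k)) n
applyUpTo-+ f zero    n = refl
applyUpTo-+ f (suc m) n = cong (f 0 ∷_) (applyUpTo-+ (λ k → f (suc k)) m n)

lookup-middle : ∀ {a} {A : Set a} {L : List A} xs x ys → L ≡ xs ++ x ∷ ys →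
                ∃ λ (j : Fin (length L)) → toℕ j ≡ length xs × lookup L j ≡ x
lookup-middle []       x ys refl = zero , refl , refl
lookup-middle (_ ∷ xs) x ys refl with j , toℕ-j , lookup-j ← lookup-middle xs x ys refl =
  suc j , cong suc toℕ-j , lookup-j

m≤[n∸1]/2⇒m*2<n : ∀ {m} n → 0 < m → m ≤ (n ∸ 1) / 2 → m * 2 < n
m≤[n∸1]/2⇒m*2<n zero    0<m m≤0 = contradiction (≤-trans 0<m m≤0) λ ()
m≤[n∸1]/2⇒m*2<n (suc n) _   m≤  = s≤s (≤-trans (*-monoˡ-≤ 2 m≤) (m/n*n≤m n 2))

m*2≤n⇒n≤[n∸m]*2 : ∀ m {n} → m * 2 ≤ n → n ≤ (n ∸ m) * 2
m*2≤n⇒n≤[n∸m]*2 m {n} m*2≤n = subst (n ≤_) (sym (*-distribʳ-∸ 2 n m)) (m+n≤o⇒m≤o∸n n (begin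
  n + m * 2 ≤⟨ +-monoʳ-≤ n m*2≤n ⟩
  n + n     ≡⟨ cong (λ k → n + k) (+-identityʳ n) ⟨
  2 * n     ≡⟨ *-comm 2 n ⟩
  n * 2     ∎))
  where open ≤-Reasoning

n≤m*2⇒[n+1]/2<1+m : ∀ {m n} → n ≤ m * 2 → (n + 1) / 2 < suc m
n≤m*2⇒[n+1]/2<1+m {m} {n} n≤m*2 =
  m<n*o⇒m/o<n (subst (λ k → suc k ≤ suc m * 2) (+-comm 1 n) (s≤s (s≤s n≤m*2)))

n*[n∸m]≤n^2 : ∀ n m → n * (n ∸ m) ≤ n ^ 2
n*[n∸m]≤n^2 n m =
  subst (n * (n ∸ m) ≤_) (cong (n *_) (sym (*-identityʳ n))) (*-monoʳ-≤ n (m∸n≤m n m))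

n^2∸n*[n∸m]≡n*m : ∀ {m n} → m ≤ n → n ^ 2 ∸ n * (n ∸ m) ≡ n * m
n^2∸n*[n∸m]≡n*m {m} {n} m≤n = begin
  n ^ 2 ∸ n * (n ∸ m)               ≡⟨ cong (λ k → n * k ∸ n * (n ∸ m)) (*-identityʳ n) ⟩
  n * n ∸ n * (n ∸ m)               ≡⟨ cong (λ k → n * k ∸ n * (n ∸ m)) (m∸n+n≡m m≤n) ⟨
  n * (n ∸ m + m) ∸ n * (n ∸ m)     ≡⟨ cong (_∸ n * (n ∸ m)) (*-distribˡ-+ n (n ∸ m) m) ⟩
  n * (n ∸ m) + n * m ∸ n * (n ∸ m) ≡⟨ m+n∸m≡n (n * (n ∸ m)) (n * m) ⟩
  n * m                             ∎
  where open ≡-Reasoning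

genus<n*m : ∀ n m → 0 < n → n ≤ m * 2 → genus n < n * m
genus<n*m n@(suc _) m _ n≤m*2 = m<n*o⇒m/o<n (begin-strict
  n ^ 2 ∸ 1   <⟨ n<1+n _ ⟩
  n ^ 2       ≡⟨ cong (n *_) (*-identityʳ n) ⟩
  n * n       ≤⟨ *-monoʳ-≤ n n≤m*2 ⟩
  n * (m * 2) ≡⟨ *-assoc n m 2 ⟨
  n * m * 2   ∎)
  where open ≤-Reasoning

normEntry-secondHalf : ∀ p {j b} → (p + 1) / 2 < suc j → b ≤ p ^ 2 →
                       normEntry p j b ≡ ℤ.- (+ (p ^ 2 ∸ b))
normEntry-secondHalf p {j} {b} inSecondHalf b≤p²
  rewrite dec-true ((p + 1) / 2 <? suc j) inSecondHalf =
  trans (ℤ.m-n≡m⊖n b (p ^ 2)) (ℤ.⊖-≤ b≤p²)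

omega-conj : ∀ p {b} → genus p < b → omega p b ≡ conj (p ^ 2 ∸ b)
omega-conj p {b} g<b rewrite dec-false (b ≤? genus p) (<⇒≱ g<b) = refl

beta-split : ∀ {p i} → i ≤ p →
             beta p i ≡ applyUpTo (λ k → i + k * p) (p ∸ i)
                        ++ p * (p ∸ i) ∷ applyUpTo (λ k → i + (p ∸ i + k) * p) i
beta-split {p} {i} i≤p = begin
  sort (map f (upTo p) ++ [ x ])        ≡⟨ cong (λ l → sort (l ++ [ x ])) (map-upTo f p) ⟩
  sort (applyUpTo f p ++ [ x ])         ≡⟨ cong (λ n → sort (applyUpTo f n ++ [ x ])) (m∸n+n≡m i≤p) ⟨
  sort (applyUpTo f (m + i) ++ [ x ])   ≡⟨ cong (λ l → sort (l ++ [ x ])) (applyUpTo-+ f m i) ⟩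
  sort ((as ++ bs) ++ [ x ])            ≡⟨ sort-separated x as++bs↗ as≤x x≤bs ⟩
  as ++ x ∷ bs                          ∎
  where
  open ≡-Reasoning
  m = p ∸ i
  x = p * m
  f : ℕ → ℕ
  f k = i + k * p
  as = applyUpTo f m
  bs = applyUpTo (λ k → f (m + k)) i
  as++bs↗ : Sorted (as ++ bs)
  as++bs↗ = subst Sorted (applyUpTo-+ f m i)
    (applyUpTo⁺₂ ≤-totalOrder f (m + i) λ k → +-monoʳ-≤ i (m≤n+m (k * p) p))
  as≤x : All (_≤ x) as
  as≤x = All.applyUpTo⁺₁ f m λ {k} k<m →
    ≤-trans (+-monoˡ-≤ (k * p) i≤p) (≤-trans (*-monoˡ-≤ p k<m) (≤-reflexive (*-comm m p)))
  x≤bs : All (x ≤_) bs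
  x≤bs = All.applyUpTo⁺₂ (λ k → f (m + k)) i λ k →
    ≤-trans (≤-reflexive (*-comm p m)) (≤-trans (*-monoˡ-≤ p (m≤m+n m k)) (m≤n+m _ i))

beta-index : ∀ {p i} → i ≤ p →
             ∃ λ (j : Fin (length (beta p i))) → toℕ j ≡ p ∸ i × lookup (beta p i) j ≡ p * (p ∸ i)
beta-index {p} {i} i≤p with j , toℕ-j , lookup-j ← lookup-middle _ _ _ (beta-split i≤p) =
  j , trans toℕ-j (length-applyUpTo _ (p ∸ i)) , lookup-j

lemma3p24 : (p i : ℕ) → Prime p → p ≢ 2 → 1 ≤ i → i ≤ (p ∸ 1) / 2 →
    Σ (Fin (length (beta p i))) (λ j →
      (lookup (beta p i) j ≡ p * (p ∸ i))
      × ((p + 1) / 2 < suc (toℕ j))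
      × (normEntry p (toℕ j) (lookup (beta p i) j) ≡ ℤ.- (+ (p * i))))
    × (conj (p * i) ∈ hodgeClass p (beta p i))
lemma3p24 p i _ _ 1≤i i≤[p∸1]/2 = (j , lookup-j , inSecondHalf , normalised) , conj-pi∈
  where
  i*2<p : i * 2 < p
  i*2<p = m≤[n∸1]/2⇒m*2<n p 1≤i i≤[p∸1]/2
  i≤p : i ≤ p
  i≤p = ≤-trans (m≤m*n i 2) (<⇒≤ i*2<p)
  p≤[p∸i]*2 : p ≤ (p ∸ i) * 2
  p≤[p∸i]*2 = m*2≤n⇒n≤[n∸m]*2 i (<⇒≤ i*2<p)
  p²∸p[p∸i]≡p*i : p ^ 2 ∸ p * (p ∸ i) ≡ p * i
  p²∸p[p∸i]≡p*i = n^2∸n*[n∸m]≡n*m i≤p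
  j : Fin (length (beta p i))
  j = proj₁ (beta-index i≤p)
  lookup-j : lookup (beta p i) j ≡ p * (p ∸ i)
  lookup-j = proj₂ (proj₂ (beta-index i≤p))
  inSecondHalf : (p + 1) / 2 < suc (toℕ j)
  inSecondHalf = subst (λ t → (p + 1) / 2 < suc t) (sym (proj₁ (proj₂ (beta-index i≤p))))
                       (n≤m*2⇒[n+1]/2<1+m p≤[p∸i]*2)
  normalised : normEntry p (toℕ j) (lookup (beta p i) j) ≡ ℤ.- (+ (p * i))
  normalised = begin
    normEntry p (toℕ j) (lookup (beta p i) j) ≡⟨ cong (normEntry p (toℕ j)) lookup-j ⟩
    normEntry p (toℕ j) (p * (p ∸ i))         ≡⟨ normEntry-secondHalf p inSecondHalf (n*[n∸m]≤n^2 p i) ⟩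
    ℤ.- (+ (p ^ 2 ∸ p * (p ∸ i)))             ≡⟨ cong (λ c → ℤ.- (+ c)) p²∸p[p∸i]≡p*i ⟩
    ℤ.- (+ (p * i))                           ∎
    where open ≡-Reasoning
  conj-pi∈ : conj (p * i) ∈ hodgeClass p (beta p i)
  conj-pi∈ = subst (_∈ hodgeClass p (beta p i))
    (trans (omega-conj p (genus<n*m p (p ∸ i) (≤-<-trans z≤n i*2<p) p≤[p∸i]*2))
           (cong conj p²∸p[p∸i]≡p*i))
    (∈-map⁺ (omega p) (subst (_∈ beta p i) lookup-j (∈-lookup j)))
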